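{- Let $D$ be a digraph with at least three vertices whose niche graph $\mathcal{N}(D)$ is connected. If $D$ has two distinct vertices which are true twins in $D$, then $\mathcal{N}(D)$ contains a triangle.
   Context: The niche graph $\mathcal{N}(D)$ of a digraph $D$ has vertex set $V(D)$, and two distinct vertices are adjacent iff they have a common out-neighbor in $D$ or a common in-neighbor in $D$. Two vertices $u,v$ of $D$ are true twins in $D$ if $N^+_D(u)=N^+_D(v)$ and $N^-_D(u)=N^-_D(v)$. -}

module Defs where

open import Data.Nat using (ℕ)
open import Data.Fin using (Fin)
open import Data.Bool using (Bool; true; false)
open import Data.Product using (∃-syntax; _×_)
open import Data.Sum using (_⊎_)
open import Relation.Nullary using (¬_)
open import Relation.Binary.PropositionalEquality using (_≡_)
open import Relation.Binary.Construct.Closure.ReflexiveTransitive using (Star)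

record Digraph (n : ℕ) : Set where
  field
    arc      : Fin n → Fin n → Bool
    loopless : ∀ v → arc v v ≡ false

open Digraph public

Arc : ∀ {n} → Digraph n → Fin n → Fin n → Set
Arc D u v = arc D u v ≡ true

NicheAdj : ∀ {n} → Digraph n → Fin n → Fin n → Set
NicheAdj D u v =
  ¬ (u ≡ v) ×
  ((∃[ w ] (Arc D u w × Arc D v w)) ⊎ (∃[ w ] (Arc D w u × Arc D w v)))

NicheConnected : ∀ {n} → Digraph n → Set
NicheConnected {n} D = ∀ (u v : Fin n) → Star (NicheAdj D) u v

NicheHasTriangle : ∀ {n} → Digraph n → Set
NicheHasTriangle {n} D =
  ∃[ x ] ∃[ y ] ∃[ z ] (NicheAdj D x y × NicheAdj D y z × NicheAdj D x z)

TrueTwins : ∀ {n} → Digraph n → Fin n → Fin n → Set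
TrueTwins {n} D u v =
  (∀ (w : Fin n) → arc D u w ≡ arc D v w) × (∀ (w : Fin n) → arc D w u ≡ arc D w v)

module Submission where

open import Defs
open import Data.Nat using (ℕ; suc; _≥_; s≤s; z≤n)
open import Data.Fin using (Fin; zero; punchIn; punchOut; _≟_)
open import Data.Fin.Properties using (punchInᵢ≢i; punchIn-injective; punchIn-punchOut)
open import Data.Product using (∃-syntax; ∃₂; _×_; _,_; proj₁; proj₂)
open import Data.Sum using (_⊎_; inj₁; inj₂; [_,_])
open import Data.Empty using (⊥-elim)
open import Function using (_∘_)
open import Relation.Nullary using (¬_; yes; no)
open import Relation.Nullary.Decidable using (_⊎-dec_)
open import Relation.Unary using (Pred; Decidable)
open import Relation.Binary using (Rel)
open import Relation.Binary.PropositionalEquality using (_≡_; _≢_; refl; sym; trans)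
open import Relation.Binary.Construct.Closure.ReflexiveTransitive using (Star; ε; _◅_)

-- Twins u, v have the same neighbours, so any common neighbour w of u and a
-- third vertex y is also a common neighbour of u and v and of v and y: u, v, y
-- form a triangle. By connectivity a walk leaves {u, v} towards some third
-- vertex, and its first step out of {u, v} supplies such a y.

module _ {a ℓ p} {A : Set a} {R : Rel A ℓ} {P : Pred A p} (P? : Decidable P) where

  star-leaves : ∀ {x y} → Star R x y → P x → ¬ P y → ∃₂ λ b c → P b × ¬ P c × R b c
  star-leaves ε px ¬py = ⊥-elim (¬py px)
  star-leaves (_◅_ {j = c} r rs) px ¬py with P? c
  ... | yes pc = star-leaves rs pc ¬py
  ... | no ¬pc = _ , _ , px , ¬pc , r

-- punchIn u never hits u, and it hits v exactly at j = punchOut u≢v.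
avoid-two : ∀ {m} (u v : Fin (suc (suc (suc m)))) → ∃[ x ] (x ≢ u × x ≢ v)
avoid-two {m} u v with u ≟ v
... | yes refl = punchIn u zero , punchInᵢ≢i u zero , punchInᵢ≢i u zero
... | no u≢v   = punchIn u (punchIn j zero) , punchInᵢ≢i u _ , x≢v
  where
  j : Fin (suc (suc m))
  j = punchOut u≢v
  x≢v : punchIn u (punchIn j zero) ≢ v
  x≢v x≡v = punchInᵢ≢i j zero
    (punchIn-injective u _ _ (trans x≡v (sym (punchIn-punchOut u≢v))))

module _ {n} {D : Digraph n} where

  twins-sym : ∀ {u v} → TrueTwins D u v → TrueTwins D v u
  twins-sym (out , in′) = sym ∘ out , sym ∘ in′

  twins-out : ∀ {u v} → TrueTwins D u v → ∀ {w} → Arc D u w → Arc D v w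
  twins-out twins {w} uw = trans (sym (proj₁ twins w)) uw

  twins-in : ∀ {u v} → TrueTwins D u v → ∀ {w} → Arc D w u → Arc D w v
  twins-in twins {w} wu = trans (sym (proj₂ twins w)) wu

  twins-triangle : ∀ {u v y} → u ≢ v → TrueTwins D u v → NicheAdj D u y → y ≢ v →
                   NicheHasTriangle D
  twins-triangle {u} {v} {y} u≢v twins u~y@(_ , inj₁ (w , uw , yw)) y≢v =
    u , v , y , (u≢v , inj₁ (w , uw , twins-out twins uw))
              , (y≢v ∘ sym , inj₁ (w , twins-out twins uw , yw)) , u~y
  twins-triangle {u} {v} {y} u≢v twins u~y@(_ , inj₂ (w , wu , wy)) y≢v =
    u , v , y , (u≢v , inj₂ (w , wu , twins-in twins wu))
              , (y≢v ∘ sym , inj₂ (w , twins-in twins wu , wy)) , u~y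

  pair-exit-triangle : ∀ {u v c y} → u ≢ v → TrueTwins D u v → c ≡ u ⊎ c ≡ v →
                       ¬ (y ≡ u ⊎ y ≡ v) → NicheAdj D c y → NicheHasTriangle D
  pair-exit-triangle u≢v twins (inj₁ refl) y∉ c~y =
    twins-triangle u≢v twins c~y (y∉ ∘ inj₂)
  pair-exit-triangle u≢v twins (inj₂ refl) y∉ c~y =
    twins-triangle (u≢v ∘ sym) (twins-sym twins) c~y (y∉ ∘ inj₁)

lemma4p2 : (n : ℕ) → n ≥ 3 → (D : Digraph n) → NicheConnected D →
           (∃[ u ] ∃[ v ] (¬ (u ≡ v) × TrueTwins D u v)) →
           NicheHasTriangle D
lemma4p2 (suc (suc (suc m))) (s≤s (s≤s (s≤s z≤n))) D conn (u , v , u≢v , twins)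
  with avoid-two u v
... | x , x≢u , x≢v
  with star-leaves (λ z → z ≟ u ⊎-dec z ≟ v) (conn u x) (inj₁ refl) [ x≢u , x≢v ]
... | _ , _ , c∈ , y∉ , c~y = pair-exit-triangle {D = D} u≢v twins c∈ y∉ c~y
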